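{- For any set $A\in\mathbf P$, there is a parameterization $\eta$ with $(A,\eta)\in\mathbf{FPT}$ such that $\eta\preccurlyeq\eta'$ for every parameterization $\eta'$ with $(A,\eta')\in\mathbf{FPT}$; that is, the filter $\mathcal F^{\preccurlyeq}_{(A,\mathbf{FPT})}$ is principal.
   Context: A Turing machine $\Phi$ is a partial decision procedure for $A$ if $\Phi(x)=1\Rightarrow x\in A$ and $\Phi(x)=0\Rightarrow x\notin A$; $\mathrm{dom}(\Phi)=\{x:\Phi(x)\in\{0,1\}\}$. An $O(n^c)$-approximation for $A$ is a partial decision procedure for $A$ halting on all inputs in time $O(n^c)$. A parameter space is a nonempty set $\Omega$ with a reflexive, transitive, directed relation $\preccurlyeq$ and an injective encoding into $\{0,1\}^+$; $|k|$ is the encoding length. A parameterization over $\Omega$ is $\eta\subseteq\{0,1\}^+\times\Omega$ such that for every $x$, $\{k:(x,k)\in\eta\}$ is nonempty and upward closed; $\eta_k=\{x:(x,k)\in\eta\}$. $\mu_\eta(x)=\min\{|k|:(x,k)\in\eta\}$; $\mathrm{gap}_{\eta_1,\eta_2}(n)=\max\{\mu_{\eta_1}(x):\mu_{\eta_2}(x)\le n\}\in\mathbb N\cup\{\infty\}$ (max of empty set is $0$); $\eta_1\preccurlyeq\eta_2$ if $\mathrm{gap}_{\eta_1,\eta_2}$ is bounded above by a computable function. $(A,\eta)\in\mathbf{FPT}$ if there are a constant $c$, a Turing machine $\Psi$ with two inputs and a computable function $f$ such that for every parameter value $k$, $\Psi(k,\cdot)$ is an $O(n^c)$-approximation for $A$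 with domain $\eta_k$ whose running time is bounded by $f(k)\cdot n^c$. -}

module Defs where

open import Data.Nat using (ℕ; zero; suc; _+_; _*_; _^_; _≤_)
open import Data.Fin using (Fin; zero; suc)
open import Data.Bool using (Bool; true; false; if_then_else_)
open import Data.List using (List; []; _∷_; _++_; map; length; replicate)
open import Data.List.NonEmpty using (List⁺; toList)
open import Data.Maybe using (Maybe; just; nothing)
open import Data.Product using (Σ; Σ-syntax; ∃; ∃-syntax; _×_; _,_)
open import Relation.Binary.PropositionalEquality using (_≡_)
open import Relation.Nullary using (¬_)

-- Strings: {0,1}^+  (false = 0, true = 1)

Str : Set
Str = List⁺ Bool

len : Str → ℕ
len x = length (toList x)

-- Tape alphabet Fin (4 + nsym):  0 = blank, 1 = '0', 2 = '1', 3 = '#',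
-- the remaining symbols are work symbols.

data Move : Set where
  L R S : Move

record TM : Set where
  field
    nsym    : ℕ
    nst     : ℕ
    δ       : Fin (suc nst) → Fin (4 + nsym) → Fin (suc nst) × Fin (4 + nsym) × Move
    halting : Fin (suc nst) → Bool

module _ (M : TM) where
  open TM M

  Sym : Set
  Sym = Fin (4 + nsym)

  blank : Sym
  blank = zero

  record Config : Set where
    constructor cfg
    field
      state : Fin (suc nst)
      left  : List Sym   -- cells to the left of the head, nearest first
      head  : Sym
      right : List Sym   -- cells to the right of the head, nearest first

  moveHead : Move → List Sym → Sym → List Sym → List Sym × Sym × List Sym
  moveHead L []       a rs = [] , blank , a ∷ rs
  moveHead L (l ∷ ls) a rs = ls , l , a ∷ rs
  moveHead R ls a []       = a ∷ ls , blank , []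
  moveHead R ls a (r ∷ rs) = a ∷ ls , r , rs
  moveHead S ls a rs       = ls , a , rs

  step : Config → Config
  step (cfg q ls a rs) with δ q a
  ... | q' , b , m with moveHead m ls b rs
  ...   | ls' , h , rs' = cfg q' ls' h rs'

  run : ℕ → Config → Config
  run zero c = c
  run (suc t) c = if halting (Config.state c) then c else run t (step c)

  -- input alphabet: 0 = '0', 1 = '1', 2 = '#'
  inSym : Fin 3 → Sym
  inSym zero = suc zero
  inSym (suc zero) = suc (suc zero)
  inSym (suc (suc zero)) = suc (suc (suc zero))

  init : List (Fin 3) → Config
  init [] = cfg zero [] blank []
  init (a ∷ as) = cfg zero [] (inSym a) (map inSym as)

  exec : List (Fin 3) → ℕ → Config
  exec w t = run t (init w)

  HaltsWithin : List (Fin 3) → ℕ → Set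
  HaltsWithin w t = halting (Config.state (exec w t)) ≡ true

  -- decision output: symbol under the head ('0' ↦ 0 = false, '1' ↦ 1 = true,
  -- anything else ↦ no output in {0,1})
  symBit : Sym → Maybe Bool
  symBit (suc zero) = just false
  symBit (suc (suc zero)) = just true
  symBit _ = nothing

  result : List (Fin 3) → ℕ → Maybe Bool
  result w t = symBit (Config.head (exec w t))

  readBits : List Sym → List Bool
  readBits [] = []
  readBits (a ∷ as) with symBit a
  ... | just b = b ∷ readBits as
  ... | nothing = []

  outWord : List (Fin 3) → ℕ → List Bool
  outWord w t = readBits (Config.head (exec w t) ∷ Config.right (exec w t))

bit : Bool → Fin 3
bit false = zero
bit true = suc zero

sep : Fin 3
sep = suc (suc zero)

bits : List Bool → List (Fin 3)
bits = map bit

-- natural numbers are given to / returned by machines in unary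
unary : ℕ → List Bool
unary n = replicate n true

Computable : (ℕ → ℕ) → Set
Computable g = Σ[ M ∈ TM ] ((n : ℕ) → Σ[ t ∈ ℕ ]
  (HaltsWithin M (bits (unary n)) t × outWord M (bits (unary n)) t ≡ unary (g n)))

record ParamSpace : Set₁ where
  field
    Ω        : Set
    _≼_      : Ω → Ω → Set
    ≼-refl   : (a : Ω) → a ≼ a
    ≼-trans  : (a b c : Ω) → a ≼ b → b ≼ c → a ≼ c
    directed : (a b : Ω) → Σ[ c ∈ Ω ] (a ≼ c × b ≼ c)
    enc      : Ω → Str
    enc-inj  : (a b : Ω) → enc a ≡ enc b → a ≡ b

  size : Ω → ℕ
  size k = len (enc k)

ComputableOn : (PS : ParamSpace) → (ParamSpace.Ω PS → ℕ) → Set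
ComputableOn PS f = Σ[ M ∈ TM ] ((k : Ω) → Σ[ t ∈ ℕ ]
  (HaltsWithin M (bits (toList (enc k))) t × outWord M (bits (toList (enc k))) t ≡ unary (f k)))
  where open ParamSpace PS

record Parameterization (PS : ParamSpace) : Set₁ where
  open ParamSpace PS
  field
    rel      : Str → Ω → Set
    nonempty : (x : Str) → Σ[ k ∈ Ω ] rel x k
    upward   : (x : Str) (k k' : Ω) → rel x k → k ≼ k' → rel x k'

-- μ_η(x) ≤ m   (μ_η(x) = min { |k| : (x,k) ∈ η }, which exists by nonemptiness)
μ≤ : {PS : ParamSpace} → Parameterization PS → Str → ℕ → Set
μ≤ {PS} η x m = Σ[ k ∈ ParamSpace.Ω PS ] (Parameterization.rel η x k × ParamSpace.size PS k ≤ m)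

-- η₁ ≼ η₂ : gap_{η₁,η₂}(n) = max { μ_{η₁}(x) : μ_{η₂}(x) ≤ n } ≤ g(n) for a computable g
_⊑_ : {PS₁ PS₂ : ParamSpace} → Parameterization PS₁ → Parameterization PS₂ → Set
η₁ ⊑ η₂ = Σ[ g ∈ (ℕ → ℕ) ] (Computable g ×
  ((n : ℕ) (x : Str) → μ≤ η₂ x n → μ≤ η₁ x (g n)))

InP : (Str → Set) → Set
InP A = Σ[ M ∈ TM ] Σ[ c ∈ ℕ ] Σ[ d ∈ ℕ ] ((x : Str) →
  let w = bits (toList x) ; T = d * len x ^ c in
  HaltsWithin M w T
  × (result M w T ≡ just true → A x)
  × (result M w T ≡ just false → ¬ A x)
  × Σ[ b ∈ Bool ] (result M w T ≡ just b))

-- (A , η) ∈ FPT ; Ψ(k, x) is run on input  enc(k) # x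
FPT : {PS : ParamSpace} → (Str → Set) → Parameterization PS → Set
FPT {PS} A η = Σ[ c ∈ ℕ ] Σ[ Ψ ∈ TM ] Σ[ f ∈ (Ω → ℕ) ] (ComputableOn PS f ×
  ((k : Ω) (x : Str) →
    let w = bits (toList (enc k)) ++ (sep ∷ bits (toList x)) ; T = f k * len x ^ c in
    HaltsWithin Ψ w T
    × (result Ψ w T ≡ just true → A x)
    × (result Ψ w T ≡ just false → ¬ A x)
    × ((Σ[ b ∈ Bool ] (result Ψ w T ≡ just b)) → rel x k)
    × (rel x k → Σ[ b ∈ Bool ] (result Ψ w T ≡ just b))))
  where
    open ParamSpace PS
    open Parameterization η

-- For A ∈ P the trivial parameterization, with a single parameter value of size 1, is already
-- in FPT: run the polynomial-time decider for A after erasing the parameter prefix, which costs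
-- two extra steps and is absorbed by the constant f(k) = d + 2. It lies below every
-- parameterization, since its μ is constantly 1 and every encoding has length at least 1.
module Submission where

open import Defs
open import Data.Bool using (Bool; true; false; if_then_else_)
open import Data.Fin using (Fin; zero; suc; toℕ)
open import Data.List using (List; []; _∷_; map)
open import Data.List.NonEmpty using (toList; _∷_)
open import Data.List.Properties using (map-cong)
open import Data.Nat using (ℕ; zero; suc; _+_; _*_; _^_; _≤_; _<_; _>_; z≤n; s≤s; _≟_; _<?_)
open import Data.Nat.Properties
  using ( ≤-refl; ≤-reflexive; ≤-trans; <-irrefl; <⇒≤; 1+n≰n; n<1+n; m<m+n; m<n⇒m<1+n
        ; +-comm; +-identityʳ; +-suc; +-mono-≤; m^n>0; m≤n⇒∃[o]m+o≡n )
open import Data.Product using (Σ-syntax; _×_; _,_)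
open import Data.Unit using (⊤; tt)
open import Function using (_∘_)
open import Relation.Binary.PropositionalEquality using (_≡_; refl; sym; trans; cong; subst; subst₂)
open import Relation.Nullary.Decidable using (does; dec-true; dec-false)

unitSpace : ParamSpace
unitSpace = record
  { Ω = ⊤ ; _≼_ = λ _ _ → ⊤ ; ≼-refl = λ _ → tt ; ≼-trans = λ _ _ _ _ _ → tt
  ; directed = λ _ _ → tt , tt , tt ; enc = λ _ → true ∷ []
  ; enc-inj = λ _ _ _ → refl }

trivial : Parameterization unitSpace
trivial = record { rel = λ _ _ → ⊤ ; nonempty = λ _ → tt , tt ; upward = λ _ _ _ _ _ → tt }

size>0 : (PS : ParamSpace) (k : ParamSpace.Ω PS) → ParamSpace.size PS k > 0
size>0 PS k with ParamSpace.enc PS k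
... | _ ∷ _ = s≤s z≤n

len^n>0 : (x : Str) (n : ℕ) → len x ^ n > 0
len^n>0 x@(_ ∷ _) n = m^n>0 (len x) n

module _ (M : TM) where
  open TM M

  run-halted : ∀ t (c : Config M) → halting (Config.state c) ≡ true → run M t c ≡ c
  run-halted zero    c h = refl
  run-halted (suc t) c h rewrite h = refl

  run-+ : ∀ t k (c : Config M) → halting (Config.state (run M t c)) ≡ true →
          run M (t + k) c ≡ run M t c
  run-+ zero    k c h = run-halted k c h
  run-+ (suc t) k c h with halting (Config.state c)
  ... | true  = refl
  ... | false = run-+ t k (step M c) h

  exec-stable : ∀ {w T T′} → HaltsWithin M w T → T ≤ T′ → exec M w T′ ≡ exec M w T
  exec-stable {w} {T} h T≤T′ with m≤n⇒∃[o]m+o≡n T≤T′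
  ... | k , refl = run-+ T k (init M w) h

  readBits-inSym : (bs : List Bool) → readBits M (map (inSym M) (bits bs)) ≡ bs
  readBits-inSym []          = refl
  readBits-inSym (false ∷ bs) = cong (false ∷_) (readBits-inSym bs)
  readBits-inSym (true ∷ bs)  = cong (true ∷_) (readBits-inSym bs)

  outWord-zero : (bs : List Bool) → outWord M (bits bs) 0 ≡ bs
  outWord-zero []       = refl
  outWord-zero (b ∷ bs) = readBits-inSym (b ∷ bs)

identityTM : TM
identityTM = record { nsym = 0 ; nst = 0 ; δ = λ _ a → zero , a , S ; halting = λ _ → true }

identity-computable : Computable (λ n → n)
identity-computable = identityTM , λ n → 0 , refl , outWord-zero identityTM (unary n)

capped-suc : ∀ {n} → Fin (suc n) → Fin (suc n)
capped-suc {zero}  zero    = zero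
capped-suc {suc n} zero    = suc zero
capped-suc {suc n} (suc i) = suc (capped-suc i)

toℕ-capped-suc : ∀ {n} (q : Fin (suc n)) → toℕ q < n → toℕ (capped-suc q) ≡ suc (toℕ q)
toℕ-capped-suc {suc n} zero    _         = refl
toℕ-capped-suc {suc n} (suc i) (s≤s i<n) = cong suc (toℕ-capped-suc i i<n)

HaltedWith : (M : TM) → List Bool → Config M → Set
HaltedWith M u c = TM.halting M (Config.state c) ≡ true × readBits M (Config.head c ∷ Config.right c) ≡ u

module Counter (m : ℕ) where
  one : Fin 4
  one = suc (suc zero)

  -- States 0, …, m each write a 1, moving left except for the last one; state m + 1 halts.
  counter : TM
  counter = record
    { nsym = 0 ; nst = suc m
    ; δ = λ q _ → capped-suc q , one , (if does (toℕ q <? m) then L else S)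
    ; halting = λ q → does (toℕ q ≟ suc m) }

  open TM counter using (halting)

  not-halted : ∀ {q} → toℕ q ≤ m → halting q ≡ false
  not-halted {q} q≤m = dec-false (toℕ q ≟ suc m) (λ q≡1+m → 1+n≰n (subst (_≤ m) q≡1+m q≤m))

  step-moving : ∀ {q h rs} t → toℕ q < m →
    run counter (suc t) (cfg q [] h rs) ≡ run counter t (cfg (capped-suc q) [] zero (one ∷ rs))
  step-moving {q} t q<m rewrite not-halted (<⇒≤ q<m) | dec-true (toℕ q <? m) q<m = refl

  step-last : ∀ {q h rs} t → toℕ q ≡ m →
    run counter (suc t) (cfg q [] h rs) ≡ run counter t (cfg (capped-suc q) [] one rs)
  step-last {q} t q≡m rewrite not-halted (≤-reflexive q≡m) | dec-false (toℕ q <? m) (<-irrefl q≡m) = refl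

  halting-after-last : ∀ {q} → toℕ q ≡ m → halting (capped-suc q) ≡ true
  halting-after-last {q} q≡m =
    dec-true (toℕ (capped-suc q) ≟ suc m)
      (trans (toℕ-capped-suc q (subst (_< suc m) (sym q≡m) (n<1+n m))) (cong suc q≡m))

  counter-run : ∀ r {q h rs n} → toℕ q + r ≡ m → readBits counter rs ≡ unary n →
    HaltedWith counter (unary (n + suc r)) (run counter (2 + r) (cfg q [] h rs))
  counter-run zero {q} {n = n} q+0≡m rs≡n =
    subst₂ (HaltedWith counter) (cong unary (sym (+-comm n 1)))
      (sym (trans (step-last 1 q≡m) (run-halted counter 1 _ halts)))
      (halts , cong (true ∷_) rs≡n)
    where
    q≡m = trans (sym (+-identityʳ (toℕ q))) q+0≡m
    halts = halting-after-last q≡m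
  counter-run (suc r) {q} {n = n} q+1+r≡m rs≡n =
    subst₂ (HaltedWith counter) (cong unary (sym (+-suc n (suc r)))) (sym (step-moving (2 + r) q<m))
      (counter-run r next+r≡m (cong (true ∷_) rs≡n))
    where
    q<m = subst (toℕ q <_) q+1+r≡m (m<m+n (toℕ q) (s≤s z≤n))
    next+r≡m = trans (cong (_+ r) (toℕ-capped-suc q (m<n⇒m<1+n q<m))) (trans (sym (+-suc (toℕ q) r)) q+1+r≡m)

constant-computableOn : (m : ℕ) → ComputableOn unitSpace (λ _ → suc m)
constant-computableOn m = counter , λ _ → 2 + m , counter-run m {h = one} {rs = []} {n = 0} refl refl
  where open Counter m

module Prefixed (M : TM) where
  open TM M

  -- The two new start states erase the prefix 1#; the states of M follow, shifted by two.
  prefixedδ : Fin (3 + nst) → Sym M → Fin (3 + nst) × Sym M × Move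
  prefixedδ zero          _ = suc zero , blank M , R
  prefixedδ (suc zero)    _ = suc (suc zero) , blank M , R
  prefixedδ (suc (suc q)) a with δ q a
  ... | q′ , b , mv = suc (suc q′) , b , mv

  prefixedHalting : Fin (3 + nst) → Bool
  prefixedHalting zero          = false
  prefixedHalting (suc zero)    = false
  prefixedHalting (suc (suc q)) = halting q

  prefixed : TM
  prefixed = record { nsym = nsym ; nst = 2 + nst ; δ = prefixedδ ; halting = prefixedHalting }

  prefixedInput : Str → List (Fin 3)
  prefixedInput x = bit true ∷ sep ∷ bits (toList x)

  -- The erased prefix cells lie at the far left, where M sees blank tape anyway.
  data BlankPadded : List (Sym M) → List (Sym M) → Set where
    []  : BlankPadded [] []
    _∷ᵇ : ∀ {ls} → BlankPadded ls [] → BlankPadded (blank M ∷ ls) []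
    _∷_ : ∀ a {ls ls′} → BlankPadded ls ls′ → BlankPadded (a ∷ ls) (a ∷ ls′)

  data Simulates : Config prefixed → Config M → Set where
    simulates : ∀ {q ls ls′ a rs} → BlankPadded ls ls′ → Simulates (cfg (suc (suc q)) ls a rs) (cfg q ls′ a rs)

  simulates′ : ∀ {q ls ls′ a a′ rs rs′} → BlankPadded ls ls′ → a ≡ a′ → rs ≡ rs′ →
    Simulates (cfg (suc (suc q)) ls a rs) (cfg q ls′ a′ rs′)
  simulates′ p refl refl = simulates p

  moveHead-padded : ∀ mv {ls ls′} b rs → BlankPadded ls ls′ →
    let (l , h , r) = moveHead prefixed mv ls b rs ; (l′ , h′ , r′) = moveHead M mv ls′ b rs in
    BlankPadded l l′ × h ≡ h′ × r ≡ r′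
  moveHead-padded L b rs []       = [] , refl , refl
  moveHead-padded L b rs (p ∷ᵇ)   = p , refl , refl
  moveHead-padded L b rs (a ∷ p)  = p , refl , refl
  moveHead-padded R b []       p = b ∷ p , refl , refl
  moveHead-padded R b (_ ∷ rs) p = b ∷ p , refl , refl
  moveHead-padded S b rs p = p , refl , refl

  step-simulates : ∀ {c c′} → Simulates c c′ → Simulates (step prefixed c) (step M c′)
  step-simulates (simulates {q} {a = a} {rs} p) with δ q a
  ... | _ , b , mv with moveHead-padded mv b rs p
  ... | p′ , h≡h′ , r≡r′ = simulates′ p′ h≡h′ r≡r′

  run-simulates : ∀ t {c c′} → Simulates c c′ → Simulates (run prefixed t c) (run M t c′)
  run-simulates zero    s = s
  run-simulates (suc t) s@(simulates {q} _) with halting q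
  ... | true  = s
  ... | false = run-simulates t (step-simulates s)

  inSym-prefixed : ∀ a → inSym prefixed a ≡ inSym M a
  inSym-prefixed zero             = refl
  inSym-prefixed (suc zero)       = refl
  inSym-prefixed (suc (suc zero)) = refl

  exec-simulates : (x : Str) (t : ℕ) →
    Simulates (exec prefixed (prefixedInput x) (2 + t)) (exec M (bits (toList x)) t)
  exec-simulates (b ∷ bs) t =
    run-simulates t (simulates′ (([] ∷ᵇ) ∷ᵇ) (inSym-prefixed (bit b)) (map-cong inSym-prefixed (bits bs)))

  halting-simulates : ∀ {c c′} → Simulates c c′ →
    prefixedHalting (Config.state c) ≡ halting (Config.state c′)
  halting-simulates (simulates _) = refl

  symBit-prefixed : ∀ a → symBit prefixed a ≡ symBit M a
  symBit-prefixed zero                = refl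
  symBit-prefixed (suc zero)          = refl
  symBit-prefixed (suc (suc zero))    = refl
  symBit-prefixed (suc (suc (suc _))) = refl

  symBit-simulates : ∀ {c c′} → Simulates c c′ →
    symBit prefixed (Config.head c) ≡ symBit M (Config.head c′)
  symBit-simulates (simulates {a = a} _) = symBit-prefixed a

  prefixed-decides : (x : Str) {T T′ : ℕ} → HaltsWithin M (bits (toList x)) T → 2 + T ≤ T′ →
    HaltsWithin prefixed (prefixedInput x) T′
    × result prefixed (prefixedInput x) T′ ≡ result M (bits (toList x)) T
  prefixed-decides x {T} halts 2+T≤T′ =
    trans (cong (prefixedHalting ∘ Config.state) stable) halts′ ,
    trans (cong (symBit prefixed ∘ Config.head) stable) (symBit-simulates sim)
    where
    sim = exec-simulates x T
    halts′ = trans (halting-simulates sim) halts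
    stable = exec-stable prefixed {prefixedInput x} halts′ 2+T≤T′

trivial-below : (PS′ : ParamSpace) (η′ : Parameterization PS′) → trivial ⊑ η′
trivial-below PS′ η′ =
  (λ n → n) , identity-computable , λ n x (k , _ , |k|≤n) → tt , tt , ≤-trans (size>0 PS′ k) |k|≤n

2+d*p≤[2+d]*p : ∀ d {p} → p > 0 → 2 + d * p ≤ (2 + d) * p
2+d*p≤[2+d]*p d p>0 = +-mono-≤ p>0 (+-mono-≤ p>0 ≤-refl)

trivial-FPT : (A : Str → Set) → InP A → FPT A trivial
trivial-FPT A (M , c , d , decides) =
  c , prefixed , (λ _ → 2 + d) , constant-computableOn (suc d) , λ _ x →
  let halts , accept , reject , b , answer = decides x
      halts′ , same = prefixed-decides x halts (2+d*p≤[2+d]*p d (len^n>0 x c))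
  in halts′ , accept ∘ trans (sym same) , reject ∘ trans (sym same) , (λ _ → tt) , (λ _ → b , trans same answer)
  where open Prefixed M

theorem10 : (A : Str → Set) → InP A →
    Σ[ PS ∈ ParamSpace ] Σ[ η ∈ Parameterization PS ]
    (FPT A η × ((PS′ : ParamSpace) (η′ : Parameterization PS′) → FPT A η′ → η ⊑ η′))
theorem10 A A∈P = unitSpace , trivial , trivial-FPT A A∈P , λ PS′ η′ _ → trivial-below PS′ η′
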